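{- Let $P$ and $Q$ be finite-dimensional posets. (a) If $\mathrm{abs}(P)\geq\dim(Q)$, then $\dim(P\times Q)=\dim(P)$ and $\mathrm{abs}(P\times Q)\geq \mathrm{abs}(P)-\dim(Q)+\mathrm{abs}(Q)$. (b) If $\min(\dim(P),\dim(Q))\geq\max(\mathrm{abs}(P),\mathrm{abs}(Q))$, then $$\max(\dim(P),\dim(Q))\ \leq\ \dim(P\times Q)\ \leq\ \dim(P)+\dim(Q)-\max(\mathrm{abs}(P),\mathrm{abs}(Q)).$$
   Context: Posets (in particular chains) are nonempty; products carry the componentwise order and the empty product is a one-point poset. The dimension $\dim(R)$ of a poset $R$ is the least cardinal $\kappa$ such that $R$ order-embeds into a product of $\kappa$ chains (equivalently, the order of $R$ is an intersection of $\kappa$ total orders on its underlying set). For a finite-dimensional poset $R$, its absorbency $\mathrm{abs}(R)$ is the largest natural number $n$ such that $\dim(R\times\prod_{i=0}^{n-1}T_i)=\dim(R)$ for every $n$-tuple of chains $(T_i)_{i\in\{0,\dots,n-1\}}$. -}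

module Defs where

open import Level using (Level; _⊔_; suc)
open import Data.Nat using (ℕ; _≤_)
open import Data.Fin using (Fin)
open import Data.Product using (Σ; _×_; _,_; proj₁; proj₂)
open import Function.Bundles using (_⇔_)
open import Relation.Binary.Bundles using (Poset; TotalOrder)
open import Relation.Binary.Structures using (IsPartialOrder; IsPreorder; IsEquivalence)
open import Data.Product.Relation.Binary.Pointwise.NonDependent using (×-poset)

private variable c ℓ ℓ' : Level

-- Posets are nonempty (standing convention of the paper).
record NEPoset (c ℓ ℓ' : Level) : Set (suc (c ⊔ ℓ ⊔ ℓ')) where
  field
    poset : Poset c ℓ ℓ'
    point : Poset.Carrier poset

record Chain (c ℓ ℓ' : Level) : Set (suc (c ⊔ ℓ ⊔ ℓ')) where
  field
    order : TotalOrder c ℓ ℓ'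
    point : TotalOrder.Carrier order

  asPoset : Poset c ℓ ℓ'
  asPoset = TotalOrder.poset order

Π-poset : {n : ℕ} → (Fin n → Poset c ℓ ℓ') → Poset c ℓ ℓ'
Π-poset {n = n} T = record
  { Carrier = (i : Fin n) → Poset.Carrier (T i)
  ; _≈_ = λ f g → ∀ i → Poset._≈_ (T i) (f i) (g i)
  ; _≤_ = λ f g → ∀ i → Poset._≤_ (T i) (f i) (g i)
  ; isPartialOrder = record
    { isPreorder = record
      { isEquivalence = record
        { refl = λ i → Poset.Eq.refl (T i)
        ; sym = λ p i → Poset.Eq.sym (T i) (p i)
        ; trans = λ p q i → Poset.Eq.trans (T i) (p i) (q i)
        }
      ; reflexive = λ p i → Poset.reflexive (T i) (p i)
      ; trans = λ p q i → Poset.trans (T i) (p i) (q i)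
      }
    ; antisym = λ p q i → Poset.antisym (T i) (p i) (q i)
    }
  }

Π-chains : {n : ℕ} → (Fin n → Chain c ℓ ℓ') → Poset c ℓ ℓ'
Π-chains T = Π-poset (λ i → Chain.asPoset (T i))

_⊗_ : Poset c ℓ ℓ' → Poset c ℓ ℓ' → Poset c ℓ ℓ'
P ⊗ Q = ×-poset P Q

OrderEmbedding : Poset c ℓ ℓ' → Poset c ℓ ℓ' → Set (c ⊔ ℓ')
OrderEmbedding P R =
  Σ (Poset.Carrier P → Poset.Carrier R) λ f →
    ∀ x y → (Poset._≤_ P x y ⇔ Poset._≤_ R (f x) (f y))

EmbedsInChains : Poset c ℓ ℓ' → ℕ → Set (suc (c ⊔ ℓ ⊔ ℓ'))
EmbedsInChains {c} {ℓ} {ℓ'} R n =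
  Σ (Fin n → Chain c ℓ ℓ') λ T → OrderEmbedding R (Π-chains T)

-- dim R = d : d is the least n such that R embeds into a product of n chains.
-- (R is finite-dimensional iff such d exists.)
Dim : Poset c ℓ ℓ' → ℕ → Set (suc (c ⊔ ℓ ⊔ ℓ'))
Dim R d = EmbedsInChains R d × (∀ m → EmbedsInChains R m → d ≤ m)

Absorbs : Poset c ℓ ℓ' → ℕ → ℕ → Set (suc (c ⊔ ℓ ⊔ ℓ'))
Absorbs {c} {ℓ} {ℓ'} R d n =
  (T : Fin n → Chain c ℓ ℓ') → Dim (R ⊗ Π-chains T) d

Abs : Poset c ℓ ℓ' → ℕ → ℕ → Set (suc (c ⊔ ℓ ⊔ ℓ'))
Abs R d a = Absorbs R d a × (∀ m → Absorbs R d m → m ≤ a)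

-- The key construction: if P absorbs a chains (dim (P × T₁ × ⋯ × Tₐ) = dim P = d) and X
-- embeds into a product of r + a chains, then P × X embeds into d + r chains, since the
-- product of P with a of those chains re-embeds into d chains.
-- (a) Q embeds into dQ ≤ aP chains (pad with one-point chains), so dim (P × Q) = dP. For
--     k = (aP ∸ dQ) + aQ chains T, Q × T embeds into dQ + (aP ∸ dQ) = aP chains, Q absorbing
--     the last aQ of them; so P × (Q × T) embeds into dP chains.
-- (b) Absorbing aP of the dQ chains realizing Q into P gives dim (P × Q) ≤ dP + dQ ∸ aP, and
--     symmetrically ≤ dP + dQ ∸ aQ; P and Q embed into P × Q, giving the lower bound.
module Submission where

open import Defs
open import Level using (Level) renaming (_⊔_ to _⊔ˡ_)
open import Data.Nat using (ℕ; _≤_; _+_; _∸_; _⊔_; _⊓_)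
open import Data.Nat.Properties
  using (≤-trans; ≤-reflexive; m≤m⊔n; m≤n⊔m; m⊓n≤m; m⊓n≤n; ⊔-lub; ⊓-glb;
         +-comm; +-∸-assoc; m+[n∸m]≡n; m∸n+n≡m; ∸-distribˡ-⊔-⊓)
open import Data.Product using (_×_; _,_; proj₁; proj₂; swap; assocˡ′; assocʳ′)
import Data.Product as Product
open import Data.Sum using (_⊎_; inj₁; [_,_])
open import Data.Unit.Polymorphic using (⊤)
open import Data.Fin using (Fin; splitAt; join; _↑ˡ_; _↑ʳ_)
open import Data.Fin.Properties using (splitAt-↑ˡ; splitAt-↑ʳ; join-splitAt)
open import Data.Vec.Functional using (_++_)
open import Function using (_∘_)
open import Function.Bundles using (mk⇔; Equivalence)
open import Relation.Binary.Bundles using (Poset)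
open import Relation.Binary.Construct.Always as Always using (Always)
open import Relation.Binary.PropositionalEquality using (sym; subst)

private variable
  c ℓ ℓ' o : Level
  P Q X Y Z X' Y' : Poset c ℓ ℓ'
  a d k m n r : ℕ

-- Records rather than the Σ-types OrderEmbedding and EmbedsInChains, so that the posets
-- involved can be inferred from the type (Agda cannot solve them through Σ).
infix 4 _↪_
record _↪_ (X Y : Poset c ℓ ℓ') : Set (c ⊔ˡ ℓ') where
  field
    map     : Poset.Carrier X → Poset.Carrier Y
    mono    : ∀ {x y} → Poset._≤_ X x y → Poset._≤_ Y (map x) (map y)
    reflect : ∀ {x y} → Poset._≤_ Y (map x) (map y) → Poset._≤_ X x y
open _↪_

toOrderEmbedding : X ↪ Y → OrderEmbedding X Y
toOrderEmbedding e = map e , λ _ _ → mk⇔ (mono e) (reflect e)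

fromOrderEmbedding : OrderEmbedding X Y → X ↪ Y
fromOrderEmbedding (f , f-ok) = record
  { map     = f
  ; mono    = λ {x} {y} → Equivalence.to (f-ok x y)
  ; reflect = λ {x} {y} → Equivalence.from (f-ok x y)
  }

↪-refl : X ↪ X
↪-refl = record { map = λ x → x ; mono = λ p → p ; reflect = λ p → p }

↪-trans : X ↪ Y → Y ↪ Z → X ↪ Z
↪-trans f g = record
  { map = map g ∘ map f ; mono = mono g ∘ mono f ; reflect = reflect f ∘ reflect g }

⊗-map : X ↪ X' → Y ↪ Y' → X ⊗ Y ↪ X' ⊗ Y'
⊗-map f g = record
  { map     = Product.map (map f) (map g)
  ; mono    = Product.map (mono f) (mono g)
  ; reflect = Product.map (reflect f) (reflect g)
  }

⊗-inj₁ : Poset.Carrier Y → X ↪ X ⊗ Y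
⊗-inj₁ {Y = Y} y = record { map = _, y ; mono = _, Poset.refl Y ; reflect = proj₁ }

⊗-inj₂ : Poset.Carrier X → Y ↪ X ⊗ Y
⊗-inj₂ {X = X} x = record { map = x ,_ ; mono = Poset.refl X ,_ ; reflect = proj₂ }

⊗-swap : X ⊗ Y ↪ Y ⊗ X
⊗-swap = record { map = swap ; mono = swap ; reflect = swap }

⊗-assocˡ : X ⊗ (Y ⊗ Z) ↪ (X ⊗ Y) ⊗ Z
⊗-assocˡ = record { map = assocˡ′ ; mono = assocˡ′ ; reflect = assocʳ′ }

⊗-assocʳ : (X ⊗ Y) ⊗ Z ↪ X ⊗ (Y ⊗ Z)
⊗-assocʳ = record { map = assocʳ′ ; mono = assocʳ′ ; reflect = assocˡ′ }

pointChain : Chain c ℓ ℓ'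
pointChain = record
  { order = record
    { Carrier = ⊤ ; _≈_ = Always ; _≤_ = Always
    ; isTotalOrder = record
      { isPartialOrder = record
        { isPreorder = record
          { isEquivalence = Always.isEquivalence ⊤ _ ; reflexive = _ ; trans = _ }
        ; antisym = _ }
      ; total = λ _ _ → inj₁ _ } }
  ; point = _ }

Fin-+-elim : (M : Fin (m + n) → Set o) →
             (∀ i → M (i ↑ˡ n)) → (∀ j → M (m ↑ʳ j)) → ∀ k → M k
Fin-+-elim {m = m} {n = n} M left right k =
  subst M (join-splitAt m n k) ([_,_] {C = M ∘ join m n} left right (splitAt m k))

module _ (S : Fin m → Chain c ℓ ℓ') (T : Fin n → Chain c ℓ ℓ') where

  private
    U : Fin m ⊎ Fin n → Chain c ℓ ℓ'
    U = [ S , T ]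

    Elem : Fin m ⊎ Fin n → Set c
    Elem s = Poset.Carrier (Chain.asPoset (U s))

    concat : Poset.Carrier (Π-chains S) → Poset.Carrier (Π-chains T) →
             (s : Fin m ⊎ Fin n) → Elem s
    concat f g = [_,_] {C = Elem} f g

    ConcatLe : (f f' : Poset.Carrier (Π-chains S)) (g g' : Poset.Carrier (Π-chains T)) →
               Fin m ⊎ Fin n → Set ℓ'
    ConcatLe f f' g g' s = Poset._≤_ (Chain.asPoset (U s)) (concat f g s) (concat f' g' s)

  Π-chains-++ : Π-chains S ⊗ Π-chains T ↪ Π-chains (S ++ T)
  Π-chains-++ = record
    { map     = λ (f , g) i → concat f g (splitAt m i)
    ; mono    = λ { {f , g} {f' , g'} (p , q) i → [_,_] {C = ConcatLe f f' g g'} p q (splitAt m i) }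
    ; reflect = λ { {f , g} {f' , g'} h →
                    (λ i → subst (ConcatLe f f' g g') (splitAt-↑ˡ m i n) (h (i ↑ˡ n)))
                  , (λ j → subst (ConcatLe f f' g g') (splitAt-↑ʳ m n j) (h (m ↑ʳ j))) }
    }

Π-chains-splitAt : (S : Fin (m + n) → Chain c ℓ ℓ') →
                   Π-chains S ↪ Π-chains (S ∘ (_↑ˡ n)) ⊗ Π-chains (S ∘ (m ↑ʳ_))
Π-chains-splitAt {m = m} {n = n} S = record
  { map     = λ f → f ∘ (_↑ˡ n) , f ∘ (m ↑ʳ_)
  ; mono    = λ p → p ∘ (_↑ˡ n) , p ∘ (m ↑ʳ_)
  ; reflect = λ { {f} {g} (p , q) →
                  Fin-+-elim (λ k → Poset._≤_ (Chain.asPoset (S k)) (f k) (g k)) p q }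
  }

record ChainEmbedding (X : Poset c ℓ ℓ') (n : ℕ) : Set (Level.suc (c ⊔ˡ ℓ ⊔ˡ ℓ')) where
  constructor _,_
  field
    chains    : Fin n → Chain c ℓ ℓ'
    embedding : X ↪ Π-chains chains

toEmbedsInChains : ChainEmbedding X n → EmbedsInChains X n
toEmbedsInChains (T , e) = T , toOrderEmbedding e

fromEmbedsInChains : EmbedsInChains X n → ChainEmbedding X n
fromEmbedsInChains (T , e) = T , fromOrderEmbedding e

chainEmbedding-∘ : X ↪ Y → ChainEmbedding Y n → ChainEmbedding X n
chainEmbedding-∘ e (T , f) = T , ↪-trans e f

Π-chainEmbedding : (T : Fin n → Chain c ℓ ℓ') → ChainEmbedding (Π-chains T) n
Π-chainEmbedding T = T , ↪-refl

chainEmbedding-⊗ : ChainEmbedding X m → ChainEmbedding Y n → ChainEmbedding (X ⊗ Y) (m + n)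
chainEmbedding-⊗ (S , e) (T , f) = S ++ T , ↪-trans (⊗-map e f) (Π-chains-++ S T)

-- Extra coordinates are padded with one-point chains.
chainEmbedding-≤ : m ≤ n → ChainEmbedding X m → ChainEmbedding X n
chainEmbedding-≤ {m = m} {n = n} {X = X} m≤n E = subst (ChainEmbedding X) (m+[n∸m]≡n m≤n)
  (chainEmbedding-∘ (⊗-inj₁ _) (chainEmbedding-⊗ E (Π-chainEmbedding points)))
  where
  points : Fin (n ∸ m) → Chain _ _ _
  points _ = pointChain

Dim-≤-↪ : Dim X d → X ↪ Y → ChainEmbedding Y m → d ≤ m
Dim-≤-↪ D e E = proj₂ D _ (toEmbedsInChains (chainEmbedding-∘ e E))

Dim-mutual-↪ : X ↪ Y → Y ↪ X → Dim X d → Dim Y d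
Dim-mutual-↪ f g D =
  toEmbedsInChains (chainEmbedding-∘ g (fromEmbedsInChains (proj₁ D))) ,
  λ _ E → Dim-≤-↪ D f (fromEmbedsInChains E)

Dim-⊗-lowerBound : Poset.Carrier P → Poset.Carrier Q → Dim P m → Dim Q n →
                   ChainEmbedding (P ⊗ Q) d → m ⊔ n ≤ d
Dim-⊗-lowerBound p q DP DQ E = ⊔-lub (Dim-≤-↪ DP (⊗-inj₁ q) E) (Dim-≤-↪ DQ (⊗-inj₂ p) E)

⊗-chainEmbedding-absorbed : Absorbs P d a → ChainEmbedding X a → ChainEmbedding (P ⊗ X) d
⊗-chainEmbedding-absorbed A (T , e) =
  chainEmbedding-∘ (⊗-map ↪-refl e) (fromEmbedsInChains (proj₁ (A T)))

-- P absorbs the last a chains of X, the first r survive.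
⊗-chainEmbedding-partlyAbsorbed : Absorbs P d a → ChainEmbedding X (r + a) →
                                  ChainEmbedding (P ⊗ X) (d + r)
⊗-chainEmbedding-partlyAbsorbed {a = a} {r = r} A (S , e) = chainEmbedding-∘
  (↪-trans (⊗-map ↪-refl (↪-trans e (↪-trans (Π-chains-splitAt S) ⊗-swap))) ⊗-assocˡ)
  (chainEmbedding-⊗ (fromEmbedsInChains (proj₁ (A (S ∘ (r ↑ʳ_))))) (Π-chainEmbedding (S ∘ (_↑ˡ a))))

Dim-⊗-absorbed : Poset.Carrier X → Dim P d → Absorbs P d a → ChainEmbedding X n → n ≤ a →
                 Dim (P ⊗ X) d
Dim-⊗-absorbed {X = X} {P = P} x D A E n≤a =
  toEmbedsInChains (⊗-chainEmbedding-absorbed {P = P} A (chainEmbedding-≤ n≤a E)) ,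
  λ _ F → Dim-≤-↪ D (⊗-inj₁ {Y = X} {X = P} x) (fromEmbedsInChains F)

Absorbs-⊗ : Poset.Carrier Q → Dim P d → Absorbs P d a → Absorbs Q m k →
            m ≤ a → Absorbs (P ⊗ Q) d ((a ∸ m) + k)
Absorbs-⊗ {Q = Q} {P = P} q D AP AQ m≤a T =
  Dim-mutual-↪ (⊗-assocˡ {X = P} {Y = Q} {Z = Π-chains T}) ⊗-assocʳ
  (Dim-⊗-absorbed {P = P} (q , λ i → Chain.point (T i)) D AP
    (⊗-chainEmbedding-partlyAbsorbed {P = Q} AQ (Π-chainEmbedding T)) (≤-reflexive (m+[n∸m]≡n m≤a)))

⊗-chainEmbedding-∸ : Absorbs P m a → ChainEmbedding Q n → a ≤ n →
                     ChainEmbedding (P ⊗ Q) ((m + n) ∸ a)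
⊗-chainEmbedding-∸ {P = P} {m = m} {Q = Q} A E a≤n =
  subst (ChainEmbedding (P ⊗ Q)) (sym (+-∸-assoc m a≤n))
    (⊗-chainEmbedding-partlyAbsorbed A (subst (ChainEmbedding Q) (sym (m∸n+n≡m a≤n)) E))

Dim-⊗-upperBound : Absorbs P m a → Absorbs Q n k → ChainEmbedding P m → ChainEmbedding Q n →
                   a ⊔ k ≤ m ⊓ n → Dim (P ⊗ Q) d → d ≤ (m + n) ∸ (a ⊔ k)
Dim-⊗-upperBound {P = P} {m = m} {a = a} {Q = Q} {n = n} {k = k} {d = d} AP AQ EP EQ a⊔k≤m⊓n D =
  subst (d ≤_) (sym (∸-distribˡ-⊔-⊓ (m + n) a k)) (⊓-glb absorbedByP absorbedByQ)
  where
  minimal : ∀ {r} → ChainEmbedding (P ⊗ Q) r → d ≤ r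
  minimal E = proj₂ D _ (toEmbedsInChains E)

  a≤n : a ≤ n
  a≤n = ≤-trans (m≤m⊔n a k) (≤-trans a⊔k≤m⊓n (m⊓n≤n m n))

  k≤m : k ≤ m
  k≤m = ≤-trans (m≤n⊔m a k) (≤-trans a⊔k≤m⊓n (m⊓n≤m m n))

  absorbedByP : d ≤ (m + n) ∸ a
  absorbedByP = minimal (⊗-chainEmbedding-∸ AP EQ a≤n)

  absorbedByQ : d ≤ (m + n) ∸ k
  absorbedByQ = subst (λ r → d ≤ r ∸ k) (+-comm n m)
    (minimal (chainEmbedding-∘ ⊗-swap (⊗-chainEmbedding-∸ AQ EP k≤m)))

lemma4p2 : {c ℓ ℓ' : Level} (P Q : NEPoset c ℓ ℓ') (dP dQ aP aQ : ℕ) →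
    Dim (NEPoset.poset P) dP → Dim (NEPoset.poset Q) dQ →
    Abs (NEPoset.poset P) dP aP → Abs (NEPoset.poset Q) dQ aQ →
    ((dQ ≤ aP →
    Dim (NEPoset.poset P ⊗ NEPoset.poset Q) dP
    × ((aPQ : ℕ) → Abs (NEPoset.poset P ⊗ NEPoset.poset Q) dP aPQ →
    (aP ∸ dQ) + aQ ≤ aPQ))
    × (aP ⊔ aQ ≤ dP ⊓ dQ →
    (d : ℕ) → Dim (NEPoset.poset P ⊗ NEPoset.poset Q) d →
    (dP ⊔ dQ ≤ d) × (d ≤ (dP + dQ) ∸ (aP ⊔ aQ))))
lemma4p2 P Q dP dQ aP aQ DP DQ (AP , _) (AQ , _) = part-a , part-b
  where
  open NEPoset P using () renaming (poset to P′; point to p)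
  open NEPoset Q using () renaming (poset to Q′; point to q)

  EP : ChainEmbedding P′ dP
  EP = fromEmbedsInChains (proj₁ DP)

  EQ : ChainEmbedding Q′ dQ
  EQ = fromEmbedsInChains (proj₁ DQ)

  part-a : dQ ≤ aP → Dim (P′ ⊗ Q′) dP × (∀ a → Abs (P′ ⊗ Q′) dP a → (aP ∸ dQ) + aQ ≤ a)
  part-a dQ≤aP =
    Dim-⊗-absorbed {P = P′} q DP AP EQ dQ≤aP ,
    λ _ (_ , maximal) → maximal _ (Absorbs-⊗ {Q = Q′} {P = P′} q DP AP AQ dQ≤aP)

  part-b : aP ⊔ aQ ≤ dP ⊓ dQ → ∀ d → Dim (P′ ⊗ Q′) d →
           dP ⊔ dQ ≤ d × d ≤ (dP + dQ) ∸ (aP ⊔ aQ)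
  part-b a⊔a≤d⊓d _ D =
    Dim-⊗-lowerBound {P = P′} {Q = Q′} p q DP DQ (fromEmbedsInChains (proj₁ D)) ,
    Dim-⊗-upperBound AP AQ EP EQ a⊔a≤d⊓d D
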